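{- For every $\tau\in(0,1]$ there is $c_0>0$ such that for all $\theta,\gamma\in(0,c_0]$ there is $n_0$ such that the following holds for all $n\geq n_0$ and $k\in\mathbb{N}$. Let $G$ be a digraph on $n$ vertices, $\mathcal{Q}$ a path system in $G$, and $\mathcal{P}_k=\{V_{ij}:i,j\in [k]\}$ a $k^2$-partition of $V(G)$. Let $G'$ and $\mathcal{P}_k'$ be the digraph and partition obtained by contracting $\mathcal{Q}$ in $G$ with respect to $\mathcal{P}_k$. Then $|\mathcal{B}_k(\mathcal{P}_k',G')|\leq |\mathcal{B}_k(\mathcal{P}_k,G)|$. Moreover, if $\mathcal{P}_k$ is a $(k^2,\tau,\gamma)$-partition of $G$ and $\mathcal{Q}$ has at most $\theta n$ edges, then $\mathcal{P}_{k}'$ is a $(k^2,\tau/2,2\gamma)$-partition of $G'$.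
   Context: A digraph is a finite directed graph without loops, with at most one edge from $a$ to $b$ for each ordered pair of distinct vertices. A path system in $G$ is a set of vertex-disjoint directed paths in $G$. A $k^2$-partition of $V(G)$ is a partition $\{V_{ij}:i,j\in[k]\}$ (parts may be empty); write $V_{i*}=\bigcup_{j}V_{ij}$, $V_{*j}=\bigcup_i V_{ij}$. $E(A,B)$ is the set of edges $ab$ with $a\in A$, $b\in B$; bad edges are $\mathcal{B}_k(\mathcal{P}_k,G)=\bigcup_{i\neq j}E(V_{i*},V_{*j})$. A $(k^2,\tau,\gamma)$-partition of a digraph on $N$ vertices is a $k^2$-partition with at most $\gamma N^2$ bad edges and $|V_{i*}|,|V_{*j}|\geq \tau N$ for all $i,j$. Contraction of $\mathcal{Q}$ with respect to $\mathcal{P}_k$: for each path $Q\in\mathcal{Q}$, going from $u$ to $v$, create a new vertex $x_Q$ whose inneighbours are those of $u$ and whose outneighbours are those of $v$ (precisely: set $\mathrm{in}(x_Q)=u$, $\mathrm{out}(x_Q)=v$, and $\mathrm{in}(y)=\mathrm{out}(y)=y$ for vertices $y$ not on paths of $\mathcal{Q}$; $G'$ has vertex set $(V(G)\setminus V(\mathcal{Q}))\cup\{x_Q:Q\in\mathcal{Q}\}$ and $yz$ is an edge of $G'$ iff $\mathrm{out}(y)\,\mathrm{in}(z)\in E(G)$); if $u\in V_{ij}$ and $v\in V_{i'j'}$, then $x_Q$ is put into part $V_{i'j}$; finally all vertices of the paths of $\mathcal{Q}$ are deleted. The updated parts form $\mathcal{P}_k'=\{V'_{ij}\}$.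
   Formalization: The parameters τ, θ and γ range only over the rationals, and the constant c₀ is taken rational as well. -}

module Defs where

open import Data.Bool using (Bool; true; false; _∧_; not)
open import Data.Nat as ℕ using (ℕ; _∸_)
open import Data.Fin using (Fin)
open import Data.Fin.Properties using () renaming (_≟_ to _≟ᶠ_)
open import Data.Integer using (+_)
open import Data.List using (List; []; _∷_; length; filterᵇ; cartesianProduct; allFin; map; _++_; concat; lookup)
open import Data.Nat.ListAction using (sum)
open import Data.Bool.ListAction using (any)
open import Data.List.NonEmpty as L⁺ using (List⁺; toList)
open import Data.List.Relation.Unary.All using (All)
open import Data.List.Relation.Unary.Unique.Propositional using (Unique)
open import Data.Product using (_×_; _,_; proj₁; proj₂)
open import Data.Sum using (_⊎_; inj₁; inj₂)
open import Data.Sum.Properties using (≡-dec)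
open import Data.Rational as ℚ using (ℚ; _/_)
open import Relation.Nullary.Decidable using (⌊_⌋; Dec)
open import Data.Unit using (⊤)
open import Relation.Binary.PropositionalEquality using (_≡_)

Graph : ℕ → Set
Graph n = Fin n → Fin n → Bool

-- no loops (at most one edge per ordered pair is automatic)
IsDigraph : ∀ {n} → Graph n → Set
IsDigraph G = ∀ a → G a a ≡ false

EdgesAlong : ∀ {n} → Graph n → Fin n → List (Fin n) → Set
EdgesAlong G a []       = ⊤
EdgesAlong G a (b ∷ bs) = (G a b ≡ true) × EdgesAlong G b bs

IsPath : ∀ {n} → Graph n → List⁺ (Fin n) → Set
IsPath G p = Unique (toList p) × EdgesAlong G (L⁺.head p) (L⁺.tail p)

IsPathSystem : ∀ {n} → Graph n → List (List⁺ (Fin n)) → Set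
IsPathSystem G Q = All (IsPath G) Q × Unique (concat (map toList Q))

pathEdges : ∀ {n} → List (List⁺ (Fin n)) → ℕ
pathEdges Q = sum (map (λ p → L⁺.length p ∸ 1) Q)

-- a k²-partition {V_ij} of Fin n: vertex a lies in V_ij iff P a = (i , j)
Partition : ℕ → ℕ → Set
Partition k n = Fin n → Fin k × Fin k

-- A finite digraph equipped with a k²-partition, given by:
-- a type of vertices with decidable equality, a list enumerating the vertices
-- (without repetition), the adjacency relation, and for each vertex
-- its first index (row i of V_ij) and second index (column j of V_ij).
record PartDigraph (k : ℕ) : Set₁ where
  field
    Vtx   : Set
    _≟_   : (x y : Vtx) → Dec (x ≡ y)
    verts : List Vtx
    adj   : Vtx → Vtx → Bool
    row   : Vtx → Fin k
    col   : Vtx → Fin k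

module _ {k : ℕ} (D : PartDigraph k) where
  open PartDigraph D

  order : ℕ
  order = length verts

  badEdges : List (Vtx × Vtx)
  badEdges = filterᵇ (λ { (a , b) → adj a b ∧ not ⌊ row a ≟ᶠ col b ⌋ })
                     (cartesianProduct verts verts)

  badCount : ℕ
  badCount = length badEdges

  rowSize : Fin k → ℕ
  rowSize i = length (filterᵇ (λ a → ⌊ row a ≟ᶠ i ⌋) verts)

  colSize : Fin k → ℕ
  colSize j = length (filterᵇ (λ a → ⌊ col a ≟ᶠ j ⌋) verts)

ℕtoℚ : ℕ → ℚ
ℕtoℚ m = + m / 1

IsTauGammaPartition : ∀ {k} → ℚ → ℚ → PartDigraph k → Set
IsTauGammaPartition τ γ D =
  (ℕtoℚ (badCount D) ℚ.≤ γ ℚ.* (ℕtoℚ (order D) ℚ.* ℕtoℚ (order D)))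
  × (∀ i → τ ℚ.* ℕtoℚ (order D) ℚ.≤ ℕtoℚ (rowSize D i))
  × (∀ j → τ ℚ.* ℕtoℚ (order D) ℚ.≤ ℕtoℚ (colSize D j))

base : ∀ {n k} → Graph n → Partition k n → PartDigraph k
base {n} G P = record
  { Vtx = Fin n ; _≟_ = _≟ᶠ_ ; verts = allFin n ; adj = G
  ; row = λ a → proj₁ (P a) ; col = λ a → proj₂ (P a) }

-- Contraction of Q in G with respect to P.
-- Vertices of G': inj₁ y for y ∈ V(G) \ V(Q), and inj₂ q (= x_Q) for the q-th path of Q.
-- in(x_Q) = first vertex u of Q, out(x_Q) = last vertex v of Q; in(y) = out(y) = y.
-- yz is an edge of G' iff y ≠ z and out(y) in(z) ∈ E(G).
-- x_Q is put into V'_{i' j} where u ∈ V_{ij}, v ∈ V_{i'j'}; i.e. the row of a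
-- vertex of G' is that of out(·) and its column that of in(·).
module _ {n k : ℕ} (G : Graph n) (Q : List (List⁺ (Fin n))) (P : Partition k n) where

  CVtx : Set
  CVtx = Fin n ⊎ Fin (length Q)

  inV : CVtx → Fin n
  inV (inj₁ y) = y
  inV (inj₂ q) = L⁺.head (lookup Q q)

  outV : CVtx → Fin n
  outV (inj₁ y) = y
  outV (inj₂ q) = L⁺.last (lookup Q q)

  onQ : Fin n → Bool
  onQ y = any (λ z → ⌊ y ≟ᶠ z ⌋) (concat (map toList Q))

  contract : PartDigraph k
  contract = record
    { Vtx = CVtx
    ; _≟_ = ≡-dec _≟ᶠ_ _≟ᶠ_
    ; verts = map inj₁ (filterᵇ (λ y → not (onQ y)) (allFin n))
              ++ map inj₂ (allFin (length Q))
    ; adj = λ y z → not ⌊ ≡-dec _≟ᶠ_ _≟ᶠ_ y z ⌋ ∧ G (outV y) (inV z)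
    ; row = λ y → proj₁ (P (outV y))
    ; col = λ z → proj₂ (P (inV z)) }

module Submission where

-- Take c₀ = τ/4 and n₀ = 0; only the vertex-disjointness of the paths is used.
-- Write out(y), in(y) for the vertex of G whose out-, resp. in-neighbourhood the
-- vertex y of G' inherits. A path with ℓ vertices becomes one vertex of G' and
-- leaves ℓ - 1 vertices of G unaccounted for, so y ↦ out(y) (and likewise y ↦ in(y))
-- lists V(G') injectively inside V(G) and misses exactly e(Q) vertices. Hence
-- |G| = |G'| + e(Q), every |V_{i*}| and |V_{*j}| drops by at most e(Q), and
-- (y, z) ↦ (out y, in z) injects the bad edges of G' into those of G. Finally
-- e(Q) ≤ θn ≤ τn/4 ≤ n/4 gives |V'_{i*}| ≥ 3τn/4 ≥ τ|G'|/2 and 3n ≤ 4|G'|, hence n² ≤ 2|G'|².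

open import Defs

open import Data.Bool using (Bool; true; false; T; T?; not; _∧_)
open import Data.Empty using (⊥-elim)
open import Data.Fin using (Fin)
open import Data.Fin.Properties using (_≟_)
import Data.Integer as ℤ
import Data.Integer.Properties as ℤ
open import Data.List using (List; []; _∷_; _++_; length; map; concat; filter; filterᵇ; lookup; allFin; cartesianProduct)
open import Data.List.Properties
  using (length-++; length-map; length-filter; length-tabulate; filter-++; map-++; ++-assoc; map-∘; map-id; map-cong; map-tabulate; tabulate-lookup)
open import Data.List.Membership.Propositional using (_∈_)
open import Data.List.Membership.Propositional.Properties
  using (∈-∃++; ∈-map⁻; ∈-++⁻; ∈-++⁺ˡ; ∈-++⁺ʳ; ∈-allFin; ∈-filter⁺; ∈-filter⁻; ∈-cartesianProduct⁺)
open import Data.List.Membership.Propositional.Properties.WithK using (unique∧set⇒bag)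
open import Data.List.NonEmpty as List⁺ using (List⁺; toList; snocView; _∷ʳ′_)
open import Data.List.Relation.Binary.BagAndSetEquality using (∼bag⇒↭)
open import Data.List.Relation.Binary.Permutation.Propositional
  using (_↭_; prep; ↭-refl; ↭-sym; ↭-trans; ↭⇒↭ₛ; module PermutationReasoning)
open import Data.List.Relation.Binary.Permutation.Propositional.Properties
  using (↭-length; filter-↭; ∷↭∷ʳ; shift; shifts; ++⁺; ++⁺ˡ)
import Data.List.Relation.Binary.Permutation.Setoid.Properties as PermutationSetoid
open import Data.List.Relation.Binary.Subset.Propositional using (_⊆_)
import Data.List.Relation.Unary.All as All
import Data.List.Relation.Unary.All.Properties as All
open import Data.List.Relation.Unary.AllPairs as AllPairs using ([]; _∷_)
import Data.List.Relation.Unary.AllPairs.Properties as AllPairs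
open import Data.List.Relation.Unary.Any using (here; there)
import Data.List.Relation.Unary.Any as Any
open import Data.List.Relation.Unary.Any.Properties using (any⁺; any⁻)
open import Data.List.Relation.Unary.Unique.Propositional using (Unique)
import Data.List.Relation.Unary.Unique.Propositional.Properties as Unique
open import Data.Nat as ℕ using (ℕ; suc; _+_; _∸_; _≤_; z≤n; s≤s)
open import Data.Nat.Coprimality using (1-coprimeTo) renaming (sym to coprime-sym)
open import Data.Nat.ListAction using (sum)
open import Data.Nat.Properties
  using (suc-injective; ≤-trans; ≤-reflexive; +-comm; +-mono-≤; +-monoʳ-≤; +-cancelʳ-≤; *-mono-≤; *-monoˡ-≤; *-monoʳ-≤; *-cancelˡ-≤; *-distribˡ-+; m≤m+n; module ≤-Reasoning)
open import Data.Nat.Tactic.RingSolver using (solve-∀)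
open import Data.Product as Product using (_×_; _,_; proj₁; proj₂; ∃-syntax)
open import Data.Rational as ℚ using (ℚ; mkℚ; 0ℚ; 1ℚ; ½; _*_; _<_; *≤*) renaming (_≤_ to _≤ℚ_)
import Data.Rational.Properties as ℚ
open import Data.Rational.Solver using (module +-*-Solver)
open +-*-Solver using (solve; _:+_; _:*_; :-_; _:=_; con)
open import Data.Sum using (inj₁; inj₂)
open import Data.Sum.Properties using (≡-dec)
open import Function using (id; _∘_; mk⇔)
open import Relation.Binary.PropositionalEquality
  using (setoid; _≡_; refl; sym; trans; cong; cong₂; subst; subst₂; module ≡-Reasoning)
open import Relation.Nullary.Decidable using (⌊_⌋; toWitness; fromWitness)
open import Relation.Unary using (Decidable)

private variable
  A B C : Set
  xs ys : List A

T-∧-dropˡ : ∀ a b c → T ((a ∧ b) ∧ c) → T (b ∧ c)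
T-∧-dropˡ true  _ _ b∧c = b∧c
T-∧-dropˡ false _ _ ()

length-≤-⊆ : Unique xs → xs ⊆ ys → length xs ≤ length ys
length-≤-⊆ {xs = []} _ _ = z≤n
length-≤-⊆ {xs = x ∷ xs} (x∉xs ∷ xs!) xs⊆ys with ys₁ , ys₂ , refl ← ∈-∃++ (xs⊆ys (here refl)) = begin
  suc (length xs)           ≤⟨ s≤s (length-≤-⊆ xs! xs⊆ys₁++ys₂) ⟩
  suc (length (ys₁ ++ ys₂)) ≡⟨ ↭-length (shift x ys₁ ys₂) ⟨
  length (ys₁ ++ x ∷ ys₂)   ∎
  where
  open ≤-Reasoning
  xs⊆ys₁++ys₂ : xs ⊆ ys₁ ++ ys₂
  xs⊆ys₁++ys₂ {y} y∈xs with ∈-++⁻ ys₁ (xs⊆ys (there y∈xs))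
  ... | inj₁ y∈ys₁ = ∈-++⁺ˡ y∈ys₁
  ... | inj₂ (here refl) = ⊥-elim (All.lookup x∉xs y∈xs refl)
  ... | inj₂ (there y∈ys₂) = ∈-++⁺ʳ ys₁ y∈ys₂

Unique-++⁻ˡ : Unique (xs ++ ys) → Unique xs
Unique-++⁻ˡ {xs = []} _ = []
Unique-++⁻ˡ {xs = x ∷ xs} (x∉ ∷ xs++ys!) = All.++⁻ˡ xs x∉ ∷ Unique-++⁻ˡ xs++ys!

Unique-resp-↭ : xs ↭ ys → Unique xs → Unique ys
Unique-resp-↭ xs↭ys = PermutationSetoid.Unique-resp-↭ (setoid _) (↭⇒↭ₛ xs↭ys)

Unique-map-filter : {P : A → Set} (P? : Decidable P) (f : A → B) →
                    Unique (map f xs) → Unique (map f (filter P? xs))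
Unique-map-filter P? f = AllPairs.map⁺ ∘ AllPairs.filter⁺ P? ∘ AllPairs.map⁻

filterᵇ-map : (p : B → Bool) (f : A → B) (xs : List A) →
              filterᵇ p (map f xs) ≡ map f (filterᵇ (p ∘ f) xs)
filterᵇ-map p f [] = refl
filterᵇ-map p f (x ∷ xs) with p (f x)
... | true  = cong (f x ∷_) (filterᵇ-map p f xs)
... | false = filterᵇ-map p f xs

map-cartesianProduct : (f : A → C) (g : B → C) (xs : List A) (ys : List B) →
  map (Product.map f g) (cartesianProduct xs ys) ≡ cartesianProduct (map f xs) (map g ys)
map-cartesianProduct f g [] ys = refl
map-cartesianProduct f g (x ∷ xs) ys = begin
  map (Product.map f g) (map (x ,_) ys ++ cartesianProduct xs ys)
    ≡⟨ map-++ (Product.map f g) (map (x ,_) ys) _ ⟩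
  map (Product.map f g) (map (x ,_) ys) ++ map (Product.map f g) (cartesianProduct xs ys)
    ≡⟨ cong₂ _++_ (trans (sym (map-∘ ys)) (map-∘ ys)) (map-cartesianProduct f g xs ys) ⟩
  map (f x ,_) (map g ys) ++ cartesianProduct (map f xs) (map g ys) ∎
  where open ≡-Reasoning

↭-filterᵇ-not++filterᵇ : (p : A → Bool) (xs : List A) →
                         xs ↭ filterᵇ (not ∘ p) xs ++ filterᵇ p xs
↭-filterᵇ-not++filterᵇ p [] = ↭-refl
↭-filterᵇ-not++filterᵇ p (x ∷ xs) with p x
... | true  = ↭-trans (prep x (↭-filterᵇ-not++filterᵇ p xs)) (↭-sym (shift x _ _))
... | false = prep x (↭-filterᵇ-not++filterᵇ p xs)

module _ {V : List A} (e : B → A) (V′ : List B) (R : List A) (V↭ : V ↭ map e V′ ++ R) where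

  length-↭-map++ : length V ≡ length V′ + length R
  length-↭-map++ = begin
    length V                 ≡⟨ ↭-length V↭ ⟩
    length (map e V′ ++ R)   ≡⟨ length-++ (map e V′) ⟩
    length (map e V′) + length R ≡⟨ cong (_+ length R) (length-map e V′) ⟩
    length V′ + length R     ∎
    where open ≡-Reasoning

  length-filterᵇ-↭-map++ : (c : A → Bool) →
    length (filterᵇ c V) ≤ length (filterᵇ (c ∘ e) V′) + length R
  length-filterᵇ-↭-map++ c = begin
    length (filterᵇ c V)                             ≡⟨ ↭-length (filter-↭ _ V↭) ⟩
    length (filterᵇ c (map e V′ ++ R))               ≡⟨ cong length (filter-++ _ (map e V′) R) ⟩
    length (filterᵇ c (map e V′) ++ filterᵇ c R)     ≡⟨ length-++ (filterᵇ c (map e V′)) ⟩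
    length (filterᵇ c (map e V′)) + length (filterᵇ c R)
      ≡⟨ cong (λ xs → length xs + length (filterᵇ c R)) (filterᵇ-map c e V′) ⟩
    length (map e (filterᵇ (c ∘ e) V′)) + length (filterᵇ c R)
      ≤⟨ +-mono-≤ (≤-reflexive (length-map e (filterᵇ (c ∘ e) V′))) (length-filter _ R) ⟩
    length (filterᵇ (c ∘ e) V′) + length R             ∎
    where open ≤-Reasoning

Splitting : (List⁺ A → A) → Set
Splitting {A} end = (p : List⁺ A) → ∃[ rest ] toList p ↭ end p ∷ rest

head-splitting : Splitting {A} List⁺.head
head-splitting p = List⁺.tail p , ↭-refl

last-splitting : Splitting {A} List⁺.last
last-splitting p with snocView p
... | []       ∷ʳ′ y = [] , ↭-refl
... | (x ∷ xs) ∷ʳ′ y = x ∷ xs , ↭-sym (∷↭∷ʳ y (x ∷ xs))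

module _ {end : List⁺ A → A} (split : Splitting end) where

  remainder : List (List⁺ A) → List A
  remainder ps = concat (map (proj₁ ∘ split) ps)

  concat↭ends++remainder : (ps : List (List⁺ A)) →
                           concat (map toList ps) ↭ map end ps ++ remainder ps
  concat↭ends++remainder [] = ↭-refl
  concat↭ends++remainder (p ∷ ps) with rest , p↭end∷rest ← split p = begin
    toList p ++ concat (map toList ps)        ↭⟨ ++⁺ p↭end∷rest (concat↭ends++remainder ps) ⟩
    end p ∷ rest ++ map end ps ++ remainder ps ↭⟨ prep (end p) (shifts rest (map end ps)) ⟩
    end p ∷ map end ps ++ rest ++ remainder ps ∎
    where open PermutationReasoning

  length-remainder : (ps : List (List⁺ A)) →
                     length (remainder ps) ≡ sum (map (λ p → List⁺.length p ∸ 1) ps)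
  length-remainder [] = refl
  length-remainder (p ∷ ps) with rest , p↭end∷rest ← split p = begin
    length (rest ++ remainder ps)     ≡⟨ length-++ rest ⟩
    length rest + length (remainder ps) ≡⟨ cong₂ _+_ (suc-injective (sym (↭-length p↭end∷rest))) (length-remainder ps) ⟩
    List⁺.length p ∸ 1 + sum (map (λ p → List⁺.length p ∸ 1) ps) ∎
    where open ≡-Reasoning

module _ {n k : ℕ} (G : Graph n) (Q : List (List⁺ (Fin n))) (P : Partition k n) where

  pathVertices : List (Fin n)
  pathVertices = concat (map toList Q)

  offPathVertices : List (Fin n)
  offPathVertices = filterᵇ (not ∘ onQ G Q P) (allFin n)

  contractedVertices : List (CVtx G Q P)
  contractedVertices = PartDigraph.verts (contract G Q P)

  T-onQ⇒∈ : ∀ {y} → T (onQ G Q P y) → y ∈ pathVertices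
  T-onQ⇒∈ = Any.map toWitness ∘ any⁻ _ pathVertices

  ∈⇒T-onQ : ∀ {y} → y ∈ pathVertices → T (onQ G Q P y)
  ∈⇒T-onQ = any⁺ _ ∘ Any.map fromWitness

  map-endpoint : (e : CVtx G Q P → Fin n) (end : List⁺ (Fin n) → Fin n) →
                 (∀ y → e (inj₁ y) ≡ y) → (∀ q → e (inj₂ q) ≡ end (lookup Q q)) →
                 map e contractedVertices ≡ offPathVertices ++ map end Q
  map-endpoint e end e-inj₁ e-inj₂ = begin
    map e (map inj₁ offPathVertices ++ map inj₂ (allFin (length Q)))
      ≡⟨ map-++ e (map inj₁ offPathVertices) _ ⟩
    map e (map inj₁ offPathVertices) ++ map e (map inj₂ (allFin (length Q)))
      ≡⟨ cong₂ _++_ (trans (sym (map-∘ offPathVertices)) (trans (map-cong e-inj₁ offPathVertices) (map-id offPathVertices)))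
                    (trans (sym (map-∘ (allFin (length Q)))) (map-cong e-inj₂ (allFin (length Q)))) ⟩
    offPathVertices ++ map (end ∘ lookup Q) (allFin (length Q))
      ≡⟨ cong (offPathVertices ++_) (trans (map-∘ (allFin (length Q))) (cong (map end) lookups)) ⟩
    offPathVertices ++ map end Q ∎
    where
    open ≡-Reasoning
    lookups : map (lookup Q) (allFin (length Q)) ≡ Q
    lookups = trans (map-tabulate id (lookup Q)) (tabulate-lookup Q)

  module _ (pathVertices! : Unique pathVertices) where

    allFin↭offPath++path : allFin n ↭ offPathVertices ++ pathVertices
    allFin↭offPath++path = ↭-trans (↭-filterᵇ-not++filterᵇ (onQ G Q P) (allFin n))
                                   (++⁺ˡ offPathVertices onPath↭path)
      where
      onPath↭path : filterᵇ (onQ G Q P) (allFin n) ↭ pathVertices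
      onPath↭path = ∼bag⇒↭ (unique∧set⇒bag (Unique.filter⁺ onQ? (Unique.allFin⁺ n)) pathVertices!
        (mk⇔ (T-onQ⇒∈ ∘ proj₂ ∘ ∈-filter⁻ onQ? {xs = allFin n}) (∈-filter⁺ onQ? (∈-allFin _) ∘ ∈⇒T-onQ)))
        where
        onQ? : Decidable (T ∘ onQ G Q P)
        onQ? = T? ∘ onQ G Q P

    module Endpoint (e : CVtx G Q P → Fin n) {end : List⁺ (Fin n) → Fin n} (split : Splitting end)
                    (e-inj₁ : ∀ y → e (inj₁ y) ≡ y) (e-inj₂ : ∀ q → e (inj₂ q) ≡ end (lookup Q q)) where

      allFin↭endpoints++remainder : allFin n ↭ map e contractedVertices ++ remainder split Q
      allFin↭endpoints++remainder = begin
        allFin n                                             ↭⟨ allFin↭offPath++path ⟩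
        offPathVertices ++ pathVertices                      ↭⟨ ++⁺ˡ offPathVertices (concat↭ends++remainder split Q) ⟩
        offPathVertices ++ map end Q ++ remainder split Q    ≡⟨ ++-assoc offPathVertices (map end Q) _ ⟨
        (offPathVertices ++ map end Q) ++ remainder split Q  ≡⟨ cong (_++ remainder split Q) (map-endpoint e end e-inj₁ e-inj₂) ⟨
        map e contractedVertices ++ remainder split Q        ∎
        where open PermutationReasoning

      endpoints! : Unique (map e contractedVertices)
      endpoints! = Unique-++⁻ˡ (Unique-resp-↭ allFin↭endpoints++remainder (Unique.allFin⁺ n))

      order≡ : order (base G P) ≡ order (contract G Q P) + pathEdges Q
      order≡ = trans (length-↭-map++ e contractedVertices (remainder split Q) allFin↭endpoints++remainder)
                     (cong (order (contract G Q P) +_) (length-remainder split Q))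

      length-filterᵇ-≤ : (c : Fin n → Bool) →
        length (filterᵇ c (allFin n)) ≤ length (filterᵇ (c ∘ e) contractedVertices) + pathEdges Q
      length-filterᵇ-≤ c =
        ≤-trans (length-filterᵇ-↭-map++ e contractedVertices (remainder split Q) allFin↭endpoints++remainder c)
                (≤-reflexive (cong (_ +_) (length-remainder split Q)))

    module Out = Endpoint (outV G Q P) last-splitting (λ _ → refl) (λ _ → refl)
    module In  = Endpoint (inV G Q P) head-splitting (λ _ → refl) (λ _ → refl)

    rowSize-contract : ∀ i → rowSize (base G P) i ≤ rowSize (contract G Q P) i + pathEdges Q
    rowSize-contract i = Out.length-filterᵇ-≤ (λ a → ⌊ proj₁ (P a) ≟ i ⌋)

    colSize-contract : ∀ j → colSize (base G P) j ≤ colSize (contract G Q P) j + pathEdges Q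
    colSize-contract j = In.length-filterᵇ-≤ (λ a → ⌊ proj₂ (P a) ≟ j ⌋)

    badCount-contract≤ : badCount (contract G Q P) ≤ badCount (base G P)
    badCount-contract≤ = begin
      length (badEdges (contract G Q P))            ≡⟨ length-map endpoints (badEdges (contract G Q P)) ⟨
      length (map endpoints (badEdges (contract G Q P))) ≤⟨ length-≤-⊆ endpoints-bad! endpoints-bad⊆bad ⟩
      length (badEdges (base G P))                  ∎
      where
      open ≤-Reasoning
      endpoints : CVtx G Q P × CVtx G Q P → Fin n × Fin n
      endpoints = Product.map (outV G Q P) (inV G Q P)

      endpoints-pairs! : Unique (map endpoints (cartesianProduct contractedVertices contractedVertices))
      endpoints-pairs! = subst Unique (sym (map-cartesianProduct (outV G Q P) (inV G Q P) contractedVertices contractedVertices))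
        (Unique.cartesianProduct⁺ Out.endpoints! In.endpoints!)

      endpoints-bad! : Unique (map endpoints (badEdges (contract G Q P)))
      endpoints-bad! = Unique-map-filter _ endpoints endpoints-pairs!

      endpoints-bad⊆bad : map endpoints (badEdges (contract G Q P)) ⊆ badEdges (base G P)
      endpoints-bad⊆bad ∈map with (y , z) , yz∈bad′ , refl ← ∈-map⁻ endpoints ∈map =
        ∈-filter⁺ _ (∈-cartesianProduct⁺ (∈-allFin _) (∈-allFin _))
          (T-∧-dropˡ (not ⌊ ≡-dec _≟_ _≟_ y z ⌋) (G out in′) (not ⌊ proj₁ (P out) ≟ proj₂ (P in′) ⌋)
            (proj₂ (∈-filter⁻ _ {xs = cartesianProduct contractedVertices contractedVertices} yz∈bad′)))
        where
        out in′ : Fin n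
        out = outV G Q P y
        in′ = inV G Q P z

ℕtoℚ≡mkℚ : ∀ m → ℕtoℚ m ≡ mkℚ (ℤ.+ m) 0 (coprime-sym (1-coprimeTo m))
ℕtoℚ≡mkℚ m = ℚ.normalize-coprime (coprime-sym (1-coprimeTo m))

ℕtoℚ-+ : ∀ m n → ℕtoℚ (m + n) ≡ ℕtoℚ m ℚ.+ ℕtoℚ n
ℕtoℚ-+ m n rewrite ℕtoℚ≡mkℚ m | ℕtoℚ≡mkℚ n | ℤ.*-identityʳ (ℤ.+ m) | ℤ.*-identityʳ (ℤ.+ n) = refl

ℕtoℚ-* : ∀ m n → ℕtoℚ (m ℕ.* n) ≡ ℕtoℚ m * ℕtoℚ n
ℕtoℚ-* m n rewrite ℕtoℚ≡mkℚ m | ℕtoℚ≡mkℚ n = cong (ℚ._/ 1) (ℤ.pos-* m n)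

ℕtoℚ-mono-≤ : ∀ {m n} → m ≤ n → ℕtoℚ m ≤ℚ ℕtoℚ n
ℕtoℚ-mono-≤ {m} {n} m≤n rewrite ℕtoℚ≡mkℚ m | ℕtoℚ≡mkℚ n =
  *≤* (subst₂ ℤ._≤_ (sym (ℤ.*-identityʳ (ℤ.+ m))) (sym (ℤ.*-identityʳ (ℤ.+ n))) (ℤ.+≤+ m≤n))

ℕtoℚ-nonNeg : ∀ m → 0ℚ ≤ℚ ℕtoℚ m
ℕtoℚ-nonNeg m = ℕtoℚ-mono-≤ (z≤n {m})

ℕtoℚ-cancel-≤ : ∀ {m n} → ℕtoℚ m ≤ℚ ℕtoℚ n → m ≤ n
ℕtoℚ-cancel-≤ {m} {n} m≤n rewrite ℕtoℚ≡mkℚ m | ℕtoℚ≡mkℚ n =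
  ℤ.drop‿+≤+ (subst₂ ℤ._≤_ (ℤ.*-identityʳ (ℤ.+ m)) (ℤ.*-identityʳ (ℤ.+ n)) (ℚ.drop-*≤* m≤n))

square≤2*square : ∀ n n′ e → n ≤ n′ + e → 4 ℕ.* e ≤ n → n ℕ.* n ≤ 2 ℕ.* (n′ ℕ.* n′)
square≤2*square n n′ e n≤n′+e 4e≤n = *-cancelˡ-≤ 9 (begin
  9 ℕ.* (n ℕ.* n)          ≡⟨ nine n ⟩
  (3 ℕ.* n) ℕ.* (3 ℕ.* n)    ≤⟨ *-mono-≤ 3n≤4n′ 3n≤4n′ ⟩
  (4 ℕ.* n′) ℕ.* (4 ℕ.* n′)  ≡⟨ sixteen n′ ⟩
  16 ℕ.* (n′ ℕ.* n′)       ≤⟨ *-monoˡ-≤ (n′ ℕ.* n′) (m≤m+n 16 2) ⟩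
  18 ℕ.* (n′ ℕ.* n′)       ≡⟨ eighteen n′ ⟩
  9 ℕ.* (2 ℕ.* (n′ ℕ.* n′))  ∎)
  where
  open ≤-Reasoning
  nine : ∀ n → 9 ℕ.* (n ℕ.* n) ≡ (3 ℕ.* n) ℕ.* (3 ℕ.* n)
  nine = solve-∀
  sixteen : ∀ n → (4 ℕ.* n) ℕ.* (4 ℕ.* n) ≡ 16 ℕ.* (n ℕ.* n)
  sixteen = solve-∀
  eighteen : ∀ n → 18 ℕ.* (n ℕ.* n) ≡ 9 ℕ.* (2 ℕ.* (n ℕ.* n))
  eighteen = solve-∀
  3n≤4n′ : 3 ℕ.* n ≤ 4 ℕ.* n′
  3n≤4n′ = +-cancelʳ-≤ n (3 ℕ.* n) (4 ℕ.* n′) (begin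
    3 ℕ.* n + n       ≡⟨ +-comm (3 ℕ.* n) n ⟩
    4 ℕ.* n           ≤⟨ *-monoʳ-≤ 4 n≤n′+e ⟩
    4 ℕ.* (n′ + e)    ≡⟨ *-distribˡ-+ 4 n′ e ⟩
    4 ℕ.* n′ + 4 ℕ.* e  ≤⟨ +-monoʳ-≤ (4 ℕ.* n′) 4e≤n ⟩
    4 ℕ.* n′ + n      ∎)

¼ : ℚ
¼ = ½ * ½

quarter-bound : ∀ {τ e x} → 0ℚ ≤ℚ x → τ ≤ℚ 1ℚ → e ≤ℚ (τ * ¼) * x → ℕtoℚ 4 * e ≤ℚ x
quarter-bound {τ} {e} {x} 0≤x τ≤1 e≤ = begin
  ℕtoℚ 4 * e              ≤⟨ ℚ.*-monoˡ-≤-nonNeg (ℕtoℚ 4) e≤ ⟩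
  ℕtoℚ 4 * ((τ * ¼) * x)  ≡⟨ identity τ x ⟩
  τ * x                   ≤⟨ ℚ.*-monoʳ-≤-nonNeg x {{ℚ.nonNegative 0≤x}} τ≤1 ⟩
  1ℚ * x                  ≡⟨ ℚ.*-identityˡ x ⟩
  x                       ∎
  where
  open ℚ.≤-Reasoning
  identity : ∀ t x → ℕtoℚ 4 * ((t * ¼) * x) ≡ t * x
  identity = solve 2 (λ t x → con (ℕtoℚ 4) :* ((t :* con ¼) :* x) := t :* x) refl

part-size-bound : ∀ {τ x x′ r e} → 0ℚ ≤ℚ τ → 0ℚ ≤ℚ x → x′ ≤ℚ x → e ≤ℚ (τ * ¼) * x →
             τ * x ≤ℚ r ℚ.+ e → (½ * τ) * x′ ≤ℚ r
part-size-bound {τ} {x} {x′} {r} {e} 0≤τ 0≤x x′≤x e≤ τx≤r+e = begin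
  (½ * τ) * x′                        ≤⟨ ℚ.*-monoˡ-≤-nonNeg (½ * τ) {{½τ≥0}} x′≤x ⟩
  (½ * τ) * x                         ≡⟨ ℚ.+-identityʳ _ ⟨
  (½ * τ) * x ℚ.+ 0ℚ                  ≤⟨ ℚ.+-monoʳ-≤ ((½ * τ) * x) (ℚ.nonNegative⁻¹ _ {{τ¼x≥0}}) ⟩
  (½ * τ) * x ℚ.+ (τ * ¼) * x         ≡⟨ split τ x ⟩
  τ * x ℚ.- (τ * ¼) * x               ≤⟨ ℚ.+-monoˡ-≤ (ℚ.- ((τ * ¼) * x)) τx≤r+e ⟩
  (r ℚ.+ e) ℚ.- (τ * ¼) * x           ≤⟨ ℚ.+-monoˡ-≤ (ℚ.- ((τ * ¼) * x)) (ℚ.+-monoʳ-≤ r e≤) ⟩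
  (r ℚ.+ (τ * ¼) * x) ℚ.- (τ * ¼) * x ≡⟨ cancel r ((τ * ¼) * x) ⟩
  r                                   ∎
  where
  open ℚ.≤-Reasoning
  ½τ≥0 : ℚ.NonNegative (½ * τ)
  ½τ≥0 = ℚ.nonNeg*nonNeg⇒nonNeg ½ τ {{ℚ.nonNegative 0≤τ}}
  τ¼x≥0 : ℚ.NonNegative ((τ * ¼) * x)
  τ¼x≥0 = ℚ.nonNeg*nonNeg⇒nonNeg (τ * ¼) {{ℚ.nonNeg*nonNeg⇒nonNeg τ {{ℚ.nonNegative 0≤τ}} ¼}} x {{ℚ.nonNegative 0≤x}}
  split : ∀ t x → (½ * t) * x ℚ.+ (t * ¼) * x ≡ t * x ℚ.- (t * ¼) * x
  split = solve 2 (λ t x → (con ½ :* t) :* x :+ (t :* con ¼) :* x := t :* x :+ :- ((t :* con ¼) :* x)) refl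
  cancel : ∀ r b → (r ℚ.+ b) ℚ.- b ≡ r
  cancel = solve 2 (λ r b → (r :+ b) :+ :- b := r) refl

bad-count-bound : ∀ {γ x x′ b} → 0ℚ ≤ℚ γ → b ≤ℚ γ * (x * x) → x * x ≤ℚ ℕtoℚ 2 * (x′ * x′) →
                  b ≤ℚ (ℕtoℚ 2 * γ) * (x′ * x′)
bad-count-bound {γ} {x} {x′} {b} 0≤γ b≤ x²≤ = begin
  b                             ≤⟨ b≤ ⟩
  γ * (x * x)                   ≤⟨ ℚ.*-monoˡ-≤-nonNeg γ {{ℚ.nonNegative 0≤γ}} x²≤ ⟩
  γ * (ℕtoℚ 2 * (x′ * x′))      ≡⟨ ℚ.*-assoc γ (ℕtoℚ 2) (x′ * x′) ⟨
  (γ * ℕtoℚ 2) * (x′ * x′)      ≡⟨ cong (_* (x′ * x′)) (ℚ.*-comm γ (ℕtoℚ 2)) ⟩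
  (ℕtoℚ 2 * γ) * (x′ * x′)      ∎
  where open ℚ.≤-Reasoning

contract-isTauGammaPartition :
  ∀ {n k} {τ θ γ : ℚ} (G : Graph n) (Q : List (List⁺ (Fin n))) (P : Partition k n) →
  Unique (pathVertices G Q P) → 0ℚ ≤ℚ τ → τ ≤ℚ 1ℚ → 0ℚ ≤ℚ γ → θ ≤ℚ τ * ¼ →
  IsTauGammaPartition τ γ (base G P) → ℕtoℚ (pathEdges Q) ≤ℚ θ * ℕtoℚ n →
  IsTauGammaPartition (½ * τ) (ℕtoℚ 2 * γ) (contract G Q P)
contract-isTauGammaPartition {n} {τ = τ} {θ} G Q P pathVertices! 0≤τ τ≤1 0≤γ θ≤τ¼ (bad≤ , rows≥ , cols≥) E≤θn =
  bad-count-bound {x = ℕtoℚ N} {x′ = ℕtoℚ N′} 0≤γ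
    (ℚ.≤-trans (ℕtoℚ-mono-≤ (badCount-contract≤ G Q P pathVertices!)) bad≤) N²≤2N′² ,
  (λ i → part-size-bound 0≤τ (ℕtoℚ-nonNeg N) N′≤N E≤τ¼N
           (ℚ.≤-trans (rows≥ i) (ℕtoℚ-≤+E (rowSize-contract G Q P pathVertices! i)))) ,
  (λ j → part-size-bound 0≤τ (ℕtoℚ-nonNeg N) N′≤N E≤τ¼N
           (ℚ.≤-trans (cols≥ j) (ℕtoℚ-≤+E (colSize-contract G Q P pathVertices! j))))
  where
  N N′ E : ℕ
  N = order (base G P)
  N′ = order (contract G Q P)
  E = pathEdges Q

  N≡N′+E : N ≡ N′ + E
  N≡N′+E = Out.order≡ G Q P pathVertices!

  E≤τ¼N : ℕtoℚ E ≤ℚ (τ * ¼) * ℕtoℚ N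
  E≤τ¼N = ℚ.≤-trans (subst (λ m → ℕtoℚ E ≤ℚ θ * ℕtoℚ m) (sym (length-tabulate {n = n} id)) E≤θn)
                    (ℚ.*-monoʳ-≤-nonNeg (ℕtoℚ N) {{ℚ.nonNegative (ℕtoℚ-nonNeg N)}} θ≤τ¼)

  N′≤N : ℕtoℚ N′ ≤ℚ ℕtoℚ N
  N′≤N = ℕtoℚ-mono-≤ (subst (N′ ≤_) (sym N≡N′+E) (m≤m+n N′ E))

  4E≤N : 4 ℕ.* E ≤ N
  4E≤N = ℕtoℚ-cancel-≤ (subst (_≤ℚ ℕtoℚ N) (sym (ℕtoℚ-* 4 E)) (quarter-bound (ℕtoℚ-nonNeg N) τ≤1 E≤τ¼N))

  N²≤2N′² : ℕtoℚ N * ℕtoℚ N ≤ℚ ℕtoℚ 2 * (ℕtoℚ N′ * ℕtoℚ N′)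
  N²≤2N′² = subst₂ _≤ℚ_ (ℕtoℚ-* N N) (trans (ℕtoℚ-* 2 (N′ ℕ.* N′)) (cong (ℕtoℚ 2 *_) (ℕtoℚ-* N′ N′)))
                   (ℕtoℚ-mono-≤ (square≤2*square N N′ E (≤-reflexive N≡N′+E) 4E≤N))

  ℕtoℚ-≤+E : ∀ {s s′} → s ≤ s′ + E → ℕtoℚ s ≤ℚ ℕtoℚ s′ ℚ.+ ℕtoℚ E
  ℕtoℚ-≤+E {s} {s′} s≤s′+E = subst (ℕtoℚ s ≤ℚ_) (ℕtoℚ-+ s′ E) (ℕtoℚ-mono-≤ s≤s′+E)

proposition4p9 : ∀ (τ : ℚ) → 0ℚ < τ → τ ≤ℚ 1ℚ →
    ∃[ c₀ ] (0ℚ < c₀ ×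
      (∀ (θ γ : ℚ) → 0ℚ < θ → θ ≤ℚ c₀ → 0ℚ < γ → γ ≤ℚ c₀ →
        ∃[ n₀ ] (∀ (n : ℕ) → n₀ ≤ n → ∀ (k : ℕ) →
          (G : Graph n) → IsDigraph G →
          (Q : List (List⁺ (Fin n))) → IsPathSystem G Q →
          (P : Partition k n) →
            (badCount (contract G Q P) ≤ badCount (base G P))
            × (IsTauGammaPartition τ γ (base G P) →
               ℕtoℚ (pathEdges Q) ≤ℚ θ * ℕtoℚ n →
               IsTauGammaPartition (½ * τ) (ℕtoℚ 2 * γ) (contract G Q P)))))
proposition4p9 τ 0<τ τ≤1 = τ * ¼ , c₀>0 , λ θ γ _ θ≤c₀ 0<γ _ →
  0 , λ n _ k G _ Q (_ , pathVertices!) P →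
    badCount-contract≤ G Q P pathVertices! ,
    contract-isTauGammaPartition G Q P pathVertices! (ℚ.<⇒≤ 0<τ) τ≤1 (ℚ.<⇒≤ 0<γ) θ≤c₀
  where
  c₀>0 : 0ℚ < τ * ¼
  c₀>0 = ℚ.positive⁻¹ (τ * ¼) {{ℚ.pos*pos⇒pos τ {{ℚ.positive 0<τ}} ¼}}
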